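{- Let $p \ge 3$ with $p \ne 4$, and let $G_p$ be the graph constructed as follows: take a cycle $u_1u_2\cdots u_pu_1$ and, for each $i\in\{1,\dots,p\}$, add new vertices $v_i,w_i,x_i,y_i,z_i$ with edges $u_iv_i, v_iw_i, w_ix_i, x_iy_i, w_iz_i$ (so that $\{u_i,v_i,w_i,x_i,y_i,z_i\}$ induces a copy of the reduced subdivided star $T_3^*$ with central vertex $w_i$, in which $u_i$ is a leaf at distance $2$ from $w_i$ and $z_i$ is the leaf neighbor of $w_i$). If $G_p$ has order $n$, then $G_p$ is an open twin-free subcubic graph containing no $4$-cycles and satisfies $\gamma^{\mathrm{IOC}}(G_p) = \frac{5}{6} n$.
   Context: For a graph $G$, a set $S\subseteq V(G)$ is an identifying open code (IO-code) if every vertex has a neighbor in $S$ and $N_G(u)\cap S \ne N_G(v)\cap S$ for all distinct vertices $u,v$, where $N_G(v)$ is the open neighborhood. A graph is open twin-free if no two distinct vertices have the same open neighborhood; $\gamma^{\mathrm{IOC}}(G)$ is the minimum cardinality of an IO-code. A subcubic graph is a graph of maximum degree at most 3. The reduced subdivided star $T_3^*$ is obtained from $K_{1,3}$ by subdividing every edge once and then deleting one leaf. -}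

module Defs where

open import Data.Bool using (Bool; true; false; _∧_; _∨_; if_then_else_; T)
open import Data.Nat using (ℕ; zero; suc; _≤_; _≡ᵇ_)
open import Data.Fin using (Fin; toℕ; remQuot)
open import Data.Fin.Subset using (Subset; _∈_; ∣_∣; inside; outside)
open import Data.Vec using (tabulate)
open import Data.Product using (Σ; ∃; _×_; _,_; proj₁; proj₂)
open import Relation.Binary.PropositionalEquality using (_≡_; _≢_)
open import Relation.Nullary using (¬_)
open import Function.Bundles using (_⇔_)

record Graph : Set where
  field
    order : ℕ
    adj   : Fin order → Fin order → Bool

open Graph public

module _ (G : Graph) where

  Vtx : Set
  Vtx = Fin (order G)

  Adj : Vtx → Vtx → Set
  Adj u v = T (adj G u v)

  IsSimple : Set
  IsSimple = (∀ u v → Adj u v → Adj v u) × (∀ v → ¬ Adj v v)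

  N : Vtx → Subset (order G)
  N v = tabulate (λ w → if adj G v w then inside else outside)

  degree : Vtx → ℕ
  degree v = ∣ N v ∣

  Subcubic : Set
  Subcubic = ∀ v → degree v ≤ 3

  OpenTwinFree : Set
  OpenTwinFree = ∀ u v → u ≢ v → ¬ (∀ w → Adj u w ⇔ Adj v w)

  NoC4 : Set
  NoC4 = ∀ a b c d → a ≢ b → a ≢ c → a ≢ d → b ≢ c → b ≢ d → c ≢ d →
         ¬ (Adj a b × Adj b c × Adj c d × Adj d a)

  IsIOCode : Subset (order G) → Set
  IsIOCode S =
    (∀ v → ∃ λ w → Adj v w × w ∈ S) ×
    (∀ u v → u ≢ v → ¬ (∀ w → w ∈ S → (Adj u w ⇔ Adj v w)))

  γIOC≡ : ℕ → Set
  γIOC≡ k = (Σ (Subset (order G)) λ S → IsIOCode S × ∣ S ∣ ≡ k) ×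
            (∀ S → IsIOCode S → k ≤ ∣ S ∣)

-- Vertices are Fin (p * 6); vertex x corresponds to the
-- pair remQuot 6 x = (i , t) with i ∈ Fin p and type t ∈ Fin 6, where
-- t = 0,1,2,3,4,5 stands for u_i, v_i, w_i, x_i, y_i, z_i respectively.

localAdj : ℕ → ℕ → Bool
localAdj a b = edge a b ∨ edge b a
  where
  edge : ℕ → ℕ → Bool
  edge a b = ((a ≡ᵇ 0) ∧ (b ≡ᵇ 1)) ∨ ((a ≡ᵇ 1) ∧ (b ≡ᵇ 2)) ∨ ((a ≡ᵇ 2) ∧ (b ≡ᵇ 3))
           ∨ ((a ≡ᵇ 3) ∧ (b ≡ᵇ 4)) ∨ ((a ≡ᵇ 2) ∧ (b ≡ᵇ 5))

cycAdj : (p : ℕ) → Fin p → Fin p → Bool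
cycAdj p i j = next i j ∨ next j i
  where
  next : Fin p → Fin p → Bool
  next i j = (suc (toℕ i) ≡ᵇ toℕ j) ∨ ((suc (toℕ i) ≡ᵇ p) ∧ (toℕ j ≡ᵇ 0))

Gadj : (p : ℕ) → Fin p × Fin 6 → Fin p × Fin 6 → Bool
Gadj p (i , a) (j , b) =
  if (toℕ i ≡ᵇ toℕ j)
  then localAdj (toℕ a) (toℕ b)
  else ((toℕ a ≡ᵇ 0) ∧ (toℕ b ≡ᵇ 0) ∧ cycAdj p i j)

G : (p : ℕ) → Graph
G p = record { order = p Data.Nat.* 6
             ; adj   = λ x y → Gadj p (remQuot 6 x) (remQuot 6 y) }

-- G_p consists of p copies of T₃* whose roots u_i are joined along a cycle, and only the roots
-- have neighbours outside their own copy.  Hence an IO-code S must dominate and separate the five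
-- non-root vertices of every copy using vertices of that copy alone: the leaves y_i and z_i force
-- x_i and w_i into S, and the pairs (v_i, z_i), (x_i, z_i), (y_i, w_i), whose neighbourhoods differ
-- only in u_i, in y_i, and in {v_i, z_i}, force u_i, y_i and one of v_i, z_i.  So |S| ≥ 5p, and all
-- vertices except the z_i form an IO-code.  Subcubicity and the absence of 4-cycles are local,
-- except for 4-cycles through roots only, which are 4-cycles of C_p and so force p = 4.

module Submission where

open import Defs
open import Data.Bool using (Bool; true; false; T; if_then_else_; _∨_; _∧_)
import Data.Bool as Bool
open import Data.Bool.Properties using (T?; T-∨; T-∧; ∨-comm)
open import Data.Empty using (⊥; ⊥-elim)
open import Data.Fin using (Fin; toℕ; zero; suc; combine; remQuot; punchIn; punchOut)
open import Data.Fin.Properties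
  using (_≟_; any?; all?; 0≢1+n; punchIn-punchOut; toℕ-injective; toℕ<n; remQuot-combine; combine-remQuot)
import Data.Fin.Properties as Fin
open import Data.Fin.Subset using (Subset; _∈_; ∣_∣; _∩_; ∁; ⁅_⁆; Nonempty; inside; outside)
open import Data.Fin.Subset.Properties using (_∈?_; ∉⊥; x∈p∩q⁺; p∩q⊆p)
open import Data.Nat using (ℕ; _+_; _*_; _≤_; _<_; _≡ᵇ_; z≤n; s≤s)
import Data.Nat as ℕ
open import Data.Nat.Properties using (+-mono-≤; ≡ᵇ⇒≡; ≡⇒≡ᵇ; <-irrefl; *-comm; *-assoc; m≤m+n; ≤-refl)
open import Data.Product using (Σ; ∃; _×_; _,_; proj₁; proj₂; uncurry)
open import Data.Sum using (_⊎_; inj₁; inj₂)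
import Data.Sum as Sum
open import Data.Vec using (Vec; []; _∷_; _++_; concat; replicate; lookup; group; here; there)
open import Data.Vec.Properties
  using (lookup-concat; lookup-replicate; lookup∘tabulate; lookup⇒[]=; []=⇒lookup)
open import Function using (_∘_; id)
open import Function.Bundles using (_⇔_; mk⇔; Equivalence)
open import Relation.Binary.PropositionalEquality
  using (_≡_; _≢_; refl; sym; trans; cong; subst; subst₂; ≢-sym)
open import Relation.Nullary using (¬_; Dec; yes; no)
open import Relation.Nullary.Decidable using (from-yes; ¬?; _×-dec_; _→-dec_; _⊎-dec_)

∣p++q∣≡∣p∣+∣q∣ : ∀ {m n} (p : Subset m) (q : Subset n) → ∣ p ++ q ∣ ≡ ∣ p ∣ + ∣ q ∣
∣p++q∣≡∣p∣+∣q∣ []            q = refl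
∣p++q∣≡∣p∣+∣q∣ (outside ∷ p) q = ∣p++q∣≡∣p∣+∣q∣ p q
∣p++q∣≡∣p∣+∣q∣ (inside ∷ p)  q = cong ℕ.suc (∣p++q∣≡∣p∣+∣q∣ p q)

∣concat-replicate∣ : ∀ k {n} (p : Subset n) → ∣ concat (replicate k p) ∣ ≡ k * ∣ p ∣
∣concat-replicate∣ ℕ.zero    p = refl
∣concat-replicate∣ (ℕ.suc k) p =
  trans (∣p++q∣≡∣p∣+∣q∣ p _) (cong (∣ p ∣ +_) (∣concat-replicate∣ k p))

∣concat∣-lower : ∀ {k n m} (ps : Vec (Subset n) k) → (∀ i → m ≤ ∣ lookup ps i ∣) →
                 k * m ≤ ∣ concat ps ∣
∣concat∣-lower []       _ = z≤n
∣concat∣-lower (p ∷ ps) h = subst (_ ≤_) (sym (∣p++q∣≡∣p∣+∣q∣ p (concat ps)))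
  (+-mono-≤ (h zero) (∣concat∣-lower ps (h ∘ suc)))

∈-concat : ∀ {k n} (ps : Vec (Subset n) k) i j → combine i j ∈ concat ps ⇔ j ∈ lookup ps i
∈-concat ps i j = mk⇔
  (λ m → lookup⇒[]= j _ (trans (sym (lookup-concat ps i j)) ([]=⇒lookup m)))
  (λ m → lookup⇒[]= (combine i j) _ (trans (lookup-concat ps i j) ([]=⇒lookup m)))

∣p∣≤-cover : ∀ {n k} (p : Subset n) (P : Fin k → Fin n → Set) →
             (∀ m {x y} → P m x → P m y → x ≡ y) →
             (∀ x → x ∈ p → ∃ λ m → P m x) → ∣ p ∣ ≤ k
∣p∣≤-cover []            P unique cover = z≤n
∣p∣≤-cover (outside ∷ p) P unique cover =
  ∣p∣≤-cover p (λ m x → P m (suc x)) (λ m a b → Fin.suc-injective (unique m a b))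
             (λ x x∈p → cover (suc x) (there x∈p))
∣p∣≤-cover {k = ℕ.zero} (inside ∷ p) P unique cover with cover zero here
... | () , _
∣p∣≤-cover {k = ℕ.suc k} (inside ∷ p) P unique cover with cover zero here
... | m , P-m-0 = s≤s (∣p∣≤-cover p P′ (λ _ a b → Fin.suc-injective (unique _ a b)) cover′)
  where
  P′ : Fin k → Fin _ → Set
  P′ m′ x = P (punchIn m m′) (suc x)
  cover′ : ∀ x → x ∈ p → ∃ λ m′ → P′ m′ x
  cover′ x x∈p with cover (suc x) (there x∈p)
  ... | m₂ , P-m₂ with m ≟ m₂
  ...   | yes refl = ⊥-elim (0≢1+n (unique m P-m-0 P-m₂))
  ...   | no m≢m₂  = punchOut m≢m₂ , subst (λ m″ → P m″ (suc x)) (sym (punchIn-punchOut m≢m₂)) P-m₂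

∈N⇔Adj : ∀ (Γ : Graph) {v w} → w ∈ N Γ v ⇔ Adj Γ v w
∈N⇔Adj Γ {v} {w} = mk⇔
  (λ m → inside-if _ (trans (sym (lookup∘tabulate _ w)) ([]=⇒lookup m)))
  (λ a → lookup⇒[]= w (N Γ v) (trans (lookup∘tabulate _ w) (if-inside a)))
  where
  inside-if : ∀ b → (if b then inside else outside) ≡ inside → T b
  inside-if true _ = _
  if-inside : ∀ {b} → T b → (if b then inside else outside) ≡ inside
  if-inside {true} _ = refl

IsIOCode⇒OpenTwinFree : ∀ (Γ : Graph) {S} → IsIOCode Γ S → OpenTwinFree Γ
IsIOCode⇒OpenTwinFree Γ (_ , separates) u v u≢v twins = separates u v u≢v (λ w _ → twins w)

record IsC4 {A : Set} (R : A → A → Set) (a b c d : A) : Set where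
  field
    a≢b : a ≢ b
    a≢c : a ≢ c
    a≢d : a ≢ d
    b≢c : b ≢ c
    b≢d : b ≢ d
    c≢d : c ≢ d
    ab  : R a b
    bc  : R b c
    cd  : R c d
    da  : R d a

module _ {A : Set} {R : A → A → Set} where

  IsC4-rotate : ∀ {a b c d} → IsC4 R a b c d → IsC4 R b c d a
  IsC4-rotate q = record
    { a≢b = b≢c ; a≢c = b≢d ; a≢d = ≢-sym a≢b ; b≢c = c≢d ; b≢d = ≢-sym a≢c ; c≢d = ≢-sym a≢d
    ; ab = bc ; bc = cd ; cd = da ; da = ab }
    where open IsC4 q

  IsC4-reverse : (∀ {x y} → R x y → R y x) → ∀ {a b c d} → IsC4 R a b c d → IsC4 R b a d c
  IsC4-reverse R-sym q = record
    { a≢b = ≢-sym a≢b ; a≢c = b≢d ; a≢d = b≢c ; b≢c = a≢d ; b≢d = a≢c ; c≢d = ≢-sym c≢d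
    ; ab = R-sym ab ; bc = R-sym da ; cd = R-sym cd ; da = R-sym bc }
    where open IsC4 q

  IsC4-map : ∀ {B : Set} {R′ : B → B → Set} (f : A → B) → (∀ {x y} → f x ≡ f y → x ≡ y) →
             (∀ {x y} → R x y → R′ (f x) (f y)) →
             ∀ {a b c d} → IsC4 R a b c d → IsC4 R′ (f a) (f b) (f c) (f d)
  IsC4-map f f-inj f-hom q = record
    { a≢b = a≢b ∘ f-inj ; a≢c = a≢c ∘ f-inj ; a≢d = a≢d ∘ f-inj
    ; b≢c = b≢c ∘ f-inj ; b≢d = b≢d ∘ f-inj ; c≢d = c≢d ∘ f-inj
    ; ab = f-hom ab ; bc = f-hom bc ; cd = f-hom cd ; da = f-hom da }
    where open IsC4 q

  IsC4-comap : ∀ {B : Set} {R′ : B → B → Set} (f : B → A) → (∀ {x y} → R (f x) (f y) → R′ x y) →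
               ∀ {a b c d} → IsC4 R (f a) (f b) (f c) (f d) → IsC4 R′ a b c d
  IsC4-comap f f-hom q = record
    { a≢b = a≢b ∘ cong f ; a≢c = a≢c ∘ cong f ; a≢d = a≢d ∘ cong f
    ; b≢c = b≢c ∘ cong f ; b≢d = b≢d ∘ cong f ; c≢d = c≢d ∘ cong f
    ; ab = f-hom ab ; bc = f-hom bc ; cd = f-hom cd ; da = f-hom da }
    where open IsC4 q

¬IsC4⇒NoC4 : ∀ (Γ : Graph) → (∀ {a b c d} → ¬ IsC4 (Adj Γ) a b c d) → NoC4 Γ
¬IsC4⇒NoC4 Γ no-C4 a b c d a≢b a≢c a≢d b≢c b≢d c≢d (ab , bc , cd , da) = no-C4 (record
  { a≢b = a≢b ; a≢c = a≢c ; a≢d = a≢d ; b≢c = b≢c ; b≢d = b≢d ; c≢d = c≢d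
  ; ab = ab ; bc = bc ; cd = cd ; da = da })

pattern U = zero
pattern V = suc zero
pattern W = suc (suc zero)
pattern X = suc (suc (suc zero))
pattern Y = suc (suc (suc (suc zero)))
pattern Z = suc (suc (suc (suc (suc zero))))

T₃* : Graph
T₃* = record { order = 6 ; adj = λ s t → localAdj (toℕ s) (toℕ t) }

Local : Fin 6 → Fin 6 → Set
Local = Adj T₃*

Local? : ∀ s t → Dec (Local s t)
Local? s t = T? (adj T₃* s t)

adj-T₃*-sym : ∀ s t → adj T₃* s t ≡ adj T₃* t s
adj-T₃*-sym = from-yes (all? λ s → all? λ t → adj T₃* s t Bool.≟ adj T₃* t s)

Local-irrefl : ∀ s → ¬ Local s s
Local-irrefl = from-yes (all? λ s → ¬? (Local? s s))

Local-no-C4 : ∀ a b c d → a ≢ c → b ≢ d → ¬ (Local a b × Local b c × Local c d × Local d a)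
Local-no-C4 = from-yes (all? λ a → all? λ b → all? λ c → all? λ d →
  ¬? (a ≟ c) →-dec ¬? (b ≟ d) →-dec
  ¬? (Local? a b ×-dec Local? b c ×-dec Local? c d ×-dec Local? d a))

U-neighbour : ∀ t → Local U t → t ≡ V
U-neighbour = from-yes (all? λ t → Local? U t →-dec t ≟ V)

slot : Fin 6 → Fin 3
slot U = zero
slot V = zero
slot W = suc zero
slot X = suc zero
slot Y = zero
slot Z = suc (suc zero)

slot-injective : ∀ s t t′ → Local s t → Local s t′ → slot t ≡ slot t′ → t ≡ t′
slot-injective = from-yes (all? λ s → all? λ t → all? λ t′ →
  Local? s t →-dec Local? s t′ →-dec (slot t ≟ slot t′) →-dec (t ≟ t′))

L₀ : Subset 6
L₀ = ∁ ⁅ Z ⁆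

L₀-dominates : ∀ s → ∃ λ k → Local s k × k ≢ U × k ∈ L₀
L₀-dominates = from-yes (all? λ s → any? λ k → Local? s k ×-dec ¬? (k ≟ U) ×-dec k ∈? L₀)

L₀-separates : ∀ s t → s ≢ t →
  ∃ λ k → k ∈ L₀ × ((Local s k × ¬ Local t k) ⊎ (¬ Local s k × Local t k))
L₀-separates = from-yes (all? λ s → all? λ t → ¬? (s ≟ t) →-dec any? λ k →
  k ∈? L₀ ×-dec ((Local? s k ×-dec ¬? (Local? t k)) ⊎-dec (¬? (Local? s k) ×-dec Local? t k)))

-- The trace of an IO-code of G_p on one copy of T₃*: only the root has neighbours outside the
-- copy, so the other vertices must be dominated and separated inside it.
LocallyIdentifying : Subset 6 → Set
LocallyIdentifying L =
  (∀ s → s ≢ U → Nonempty (N T₃* s ∩ L)) ×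
  (∀ s t → s ≢ U → t ≢ U → s ≢ t → N T₃* s ∩ L ≢ N T₃* t ∩ L)

-- In each refuted case the two sets N s ∩ L coincide, or N s ∩ L is empty, by evaluation.
LocallyIdentifying⇒5≤∣L∣ : ∀ L → LocallyIdentifying L → 5 ≤ ∣ L ∣
LocallyIdentifying⇒5≤∣L∣ (outside ∷ _ ∷ _ ∷ _ ∷ _ ∷ _ ∷ []) (_ , separates) =
  ⊥-elim (separates V Z (λ ()) (λ ()) (λ ()) refl)
LocallyIdentifying⇒5≤∣L∣ (_ ∷ _ ∷ outside ∷ _ ∷ _ ∷ _ ∷ []) (dominates , _) =
  ⊥-elim (∉⊥ (proj₂ (dominates Z (λ ()))))
LocallyIdentifying⇒5≤∣L∣ (_ ∷ _ ∷ _ ∷ outside ∷ _ ∷ _ ∷ []) (dominates , _) =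
  ⊥-elim (∉⊥ (proj₂ (dominates Y (λ ()))))
LocallyIdentifying⇒5≤∣L∣ (_ ∷ _ ∷ _ ∷ _ ∷ outside ∷ _ ∷ []) (_ , separates) =
  ⊥-elim (separates X Z (λ ()) (λ ()) (λ ()) refl)
LocallyIdentifying⇒5≤∣L∣ (_ ∷ outside ∷ _ ∷ _ ∷ _ ∷ outside ∷ []) (_ , separates) =
  ⊥-elim (separates Y W (λ ()) (λ ()) (λ ()) refl)
LocallyIdentifying⇒5≤∣L∣ (inside ∷ inside ∷ inside ∷ inside ∷ inside ∷ _ ∷ []) _ = m≤m+n 5 _
LocallyIdentifying⇒5≤∣L∣ (inside ∷ outside ∷ inside ∷ inside ∷ inside ∷ inside ∷ []) _ = ≤-refl

module Cycle (p : ℕ) where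

  -- b follows a on the cycle 0 → 1 → ⋯ → p−1 → 0.  Also p−1 ↦ p by step, which is why
  -- ↦-functional needs the bounds.
  data _↦_ : ℕ → ℕ → Set where
    step : ∀ {a} → a ↦ ℕ.suc a
    wrap : ∀ {a} → ℕ.suc a ≡ p → a ↦ 0

  _—_ : Fin p → Fin p → Set
  i — j = toℕ i ↦ toℕ j ⊎ toℕ j ↦ toℕ i

  —-sym : ∀ {i j} → i — j → j — i
  —-sym = Sum.swap

  T-next⇒↦ : ∀ a b → T ((ℕ.suc a ≡ᵇ b) ∨ ((ℕ.suc a ≡ᵇ p) ∧ (b ≡ᵇ 0))) → a ↦ b
  T-next⇒↦ a b h with Equivalence.to T-∨ h
  ... | inj₁ e = subst (a ↦_) (≡ᵇ⇒≡ _ _ e) step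
  ... | inj₂ e with Equivalence.to T-∧ e
  ...   | e₁ , e₂ = subst (a ↦_) (sym (≡ᵇ⇒≡ b 0 e₂)) (wrap (≡ᵇ⇒≡ _ _ e₁))

  cycAdj⇒— : ∀ i j → T (cycAdj p i j) → i — j
  cycAdj⇒— i j h with Equivalence.to T-∨ h
  ... | inj₁ h′ = inj₁ (T-next⇒↦ (toℕ i) (toℕ j) h′)
  ... | inj₂ h′ = inj₂ (T-next⇒↦ (toℕ j) (toℕ i) h′)

  cycAdj-sym : ∀ i j → cycAdj p i j ≡ cycAdj p j i
  cycAdj-sym i j = ∨-comm ((ℕ.suc (toℕ i) ≡ᵇ toℕ j) ∨ ((ℕ.suc (toℕ i) ≡ᵇ p) ∧ (toℕ j ≡ᵇ 0)))
                          ((ℕ.suc (toℕ j) ≡ᵇ toℕ i) ∨ ((ℕ.suc (toℕ j) ≡ᵇ p) ∧ (toℕ i ≡ᵇ 0)))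

  ↦-functional : ∀ {a b c} → b < p → c < p → a ↦ b → a ↦ c → b ≡ c
  ↦-functional _   _   step     step     = refl
  ↦-functional b<p _   step     (wrap e) = ⊥-elim (<-irrefl e b<p)
  ↦-functional _   c<p (wrap e) step     = ⊥-elim (<-irrefl e c<p)
  ↦-functional _   _   (wrap _) (wrap _) = refl

  ↦-injective : ∀ {a b c} → a ↦ c → b ↦ c → a ≡ b
  ↦-injective step     step      = refl
  ↦-injective (wrap e) (wrap e′) = cong ℕ.pred (trans e (sym e′))

  -- Wraps land on 0, so at most one step wraps, and then the cycle is 0 → 1 → 2 → 3 → 0.
  ↦-C4 : ∀ {a b c d} → IsC4 _↦_ a b c d → p ≡ 4
  ↦-C4 q with IsC4.ab q | IsC4.bc q | IsC4.cd q | IsC4.da q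
  ... | wrap _ | wrap _ | _      | _      = ⊥-elim (IsC4.b≢c q refl)
  ... | wrap _ | _      | wrap _ | _      = ⊥-elim (IsC4.b≢d q refl)
  ... | wrap _ | _      | _      | wrap _ = ⊥-elim (IsC4.a≢b q refl)
  ... | _      | wrap _ | wrap _ | _      = ⊥-elim (IsC4.c≢d q refl)
  ... | _      | wrap _ | _      | wrap _ = ⊥-elim (IsC4.a≢c q refl)
  ... | _      | _      | wrap _ | wrap _ = ⊥-elim (IsC4.a≢d q refl)
  ... | step   | step   | step   | wrap e = sym e
  ... | step   | step   | wrap e | step   = sym e
  ... | step   | wrap e | step   | step   = sym e
  ... | wrap e | step   | step   | step   = sym e

  ↦-continue : ∀ {i j k} → toℕ i ↦ toℕ j → j — k → i ≢ k → toℕ j ↦ toℕ k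
  ↦-continue _  (inj₁ j↦k) _   = j↦k
  ↦-continue i↦j (inj₂ k↦j) i≢k = ⊥-elim (i≢k (toℕ-injective (↦-injective i↦j k↦j)))

  —-C4-oriented : ∀ {i j k l} → IsC4 _—_ i j k l → toℕ i ↦ toℕ j → p ≡ 4
  —-C4-oriented {i} {j} {k} {l} q i↦j = ↦-C4 (IsC4-map toℕ toℕ-injective id forward)
    where
    open IsC4 q
    j↦k = ↦-continue i↦j bc a≢c
    k↦l = ↦-continue j↦k cd b≢d
    l↦i = ↦-continue k↦l da (≢-sym a≢c)
    forward : IsC4 (λ x y → toℕ x ↦ toℕ y) i j k l
    forward = record { a≢b = a≢b ; a≢c = a≢c ; a≢d = a≢d ; b≢c = b≢c ; b≢d = b≢d ; c≢d = c≢d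
                     ; ab = i↦j ; bc = j↦k ; cd = k↦l ; da = l↦i }

  —-C4 : ∀ {i j k l} → IsC4 _—_ i j k l → p ≡ 4
  —-C4 q with IsC4.ab q
  ... | inj₁ i↦j = —-C4-oriented q i↦j
  ... | inj₂ j↦i = —-C4-oriented (IsC4-reverse —-sym q) j↦i

module Gₚ (p : ℕ) where

  open Cycle p

  Vertex : Set
  Vertex = Fin p × Fin 6

  data _∼_ : Vertex → Vertex → Set where
    local : ∀ {i s t} → Local s t → (i , s) ∼ (i , t)
    cycle : ∀ {i j} → i ≢ j → i — j → (i , U) ∼ (j , U)

  Gadj-same-copy : ∀ i s t → Gadj p (i , s) (i , t) ≡ adj T₃* s t
  Gadj-same-copy i s t with toℕ i ≡ᵇ toℕ i | ≡⇒≡ᵇ (toℕ i) (toℕ i) refl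
  ... | true  | _ = refl
  ... | false | ()

  Gadj-other-copy : ∀ {i j} s t → i ≢ j →
               Gadj p (i , s) (j , t) ≡ ((toℕ s ≡ᵇ 0) ∧ (toℕ t ≡ᵇ 0) ∧ cycAdj p i j)
  Gadj-other-copy {i} {j} s t i≢j with toℕ i ≡ᵇ toℕ j in e
  ... | true  = ⊥-elim (i≢j (toℕ-injective (≡ᵇ⇒≡ _ _ (subst T (sym e) _))))
  ... | false = refl

  Gadj-sym : ∀ a b → Gadj p a b ≡ Gadj p b a
  Gadj-sym (i , s) (j , t) with i ≟ j
  ... | yes refl =
    trans (Gadj-same-copy i s t) (trans (adj-T₃*-sym s t) (sym (Gadj-same-copy i t s)))
  ... | no i≢j =
    trans (Gadj-other-copy s t i≢j) (trans (swap s t) (sym (Gadj-other-copy t s (≢-sym i≢j))))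
    where
    swap : ∀ s t → (toℕ s ≡ᵇ 0) ∧ (toℕ t ≡ᵇ 0) ∧ cycAdj p i j
                 ≡ (toℕ t ≡ᵇ 0) ∧ (toℕ s ≡ᵇ 0) ∧ cycAdj p j i
    swap U U = cycAdj-sym i j
    swap U (suc _) = refl
    swap (suc _) U = refl
    swap (suc _) (suc _) = refl

  Gadj⇒∼ : ∀ a b → T (Gadj p a b) → a ∼ b
  Gadj⇒∼ (i , s) (j , t) h with i ≟ j
  ... | yes refl = local (subst T (Gadj-same-copy i s t) h)
  ... | no i≢j = cycle-edge s t (subst T (Gadj-other-copy s t i≢j) h)
    where
    cycle-edge : ∀ s t → T ((toℕ s ≡ᵇ 0) ∧ (toℕ t ≡ᵇ 0) ∧ cycAdj p i j) → (i , s) ∼ (j , t)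
    cycle-edge U U h = cycle i≢j (cycAdj⇒— i j h)

  ∼-irrefl : ∀ {a} → ¬ a ∼ a
  ∼-irrefl {_ , s} (local l) = Local-irrefl s l
  ∼-irrefl (cycle i≢i _) = i≢i refl

  -- Each neighbour of a fills one of three slots, and each slot holds at most one vertex.
  Slot : Vertex → Fin 3 → Vertex → Set
  Slot (i , U)     zero                (j , t) = j ≡ i × t ≡ V
  Slot (i , U)     (suc zero)          (j , t) = t ≡ U × toℕ i ↦ toℕ j
  Slot (i , U)     (suc (suc zero))    (j , t) = t ≡ U × toℕ j ↦ toℕ i
  Slot (i , suc s) m                   (j , t) = j ≡ i × Local (suc s) t × slot t ≡ m

  Slot-unique : ∀ a m {b c} → Slot a m b → Slot a m c → b ≡ c
  Slot-unique (i , U) zero (refl , refl) (refl , refl) = refl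
  Slot-unique (i , U) (suc zero) {j , _} {k , _} (refl , i↦j) (refl , i↦k) =
    cong (_, U) (toℕ-injective (↦-functional (toℕ<n j) (toℕ<n k) i↦j i↦k))
  Slot-unique (i , U) (suc (suc zero)) (refl , j↦i) (refl , k↦i) =
    cong (_, U) (toℕ-injective (↦-injective j↦i k↦i))
  Slot-unique (i , suc s) m {_ , t} {_ , t′} (refl , l , e) (refl , l′ , e′) =
    cong (i ,_) (slot-injective (suc s) t t′ l l′ (trans e (sym e′)))

  ∼⇒Slot : ∀ {a b} → a ∼ b → ∃ λ m → Slot a m b
  ∼⇒Slot (local {s = U} {t} l)     = zero , refl , U-neighbour t l
  ∼⇒Slot (local {s = suc s} {t} l) = slot t , refl , l , refl
  ∼⇒Slot (cycle _ (inj₁ i↦j))     = suc zero , refl , i↦j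
  ∼⇒Slot (cycle _ (inj₂ j↦i))     = suc (suc zero) , refl , j↦i

  inner-no-C4 : ∀ {i s b c d} → ¬ IsC4 _∼_ (i , suc s) b c d
  inner-no-C4 q = no-C4 a≢c b≢d ab bc cd da
    where
    open IsC4 q
    no-C4 : ∀ {i s b c d} → (i , suc s) ≢ c → b ≢ d →
            (i , suc s) ∼ b → b ∼ c → c ∼ d → d ∼ (i , suc s) → ⊥
    no-C4 a≢c b≢d (local ab) (local bc) (local cd) (local da) =
      Local-no-C4 _ _ _ _ (a≢c ∘ cong (_ ,_)) (b≢d ∘ cong (_ ,_)) (ab , bc , cd , da)
    no-C4 _ _   (local _) (local _)      (cycle i≢i _) (local _) = i≢i refl
    no-C4 _ _   (local _) (cycle i≢i _)  (local _)     (local _) = i≢i refl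
    no-C4 _ b≢d (local _) (cycle _ _)    (cycle _ _)   (local _) = b≢d refl

  root-edge : ∀ {i j} → (i , U) ∼ (j , U) → i — j
  root-edge (cycle _ i—j) = i—j

  ∼-no-C4 : p ≢ 4 → ∀ {a b c d} → ¬ IsC4 _∼_ a b c d
  ∼-no-C4 _ {_ , suc _} q = inner-no-C4 q
  ∼-no-C4 _ {_ , U} {_ , suc _} q = inner-no-C4 (IsC4-rotate q)
  ∼-no-C4 _ {_ , U} {_ , U} {_ , suc _} q = inner-no-C4 (IsC4-rotate (IsC4-rotate q))
  ∼-no-C4 _ {_ , U} {_ , U} {_ , U} {_ , suc _} q =
    inner-no-C4 (IsC4-rotate (IsC4-rotate (IsC4-rotate q)))
  ∼-no-C4 p≢4 {_ , U} {_ , U} {_ , U} {_ , U} q = p≢4 (—-C4 (IsC4-comap (_, U) root-edge q))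

  vertex : Fin p → Fin 6 → Fin (p * 6)
  vertex = combine

  rq : Fin (p * 6) → Vertex
  rq = remQuot 6

  rq-injective : ∀ {x y} → rq x ≡ rq y → x ≡ y
  rq-injective {x} {y} e =
    trans (sym (combine-remQuot {p} 6 x)) (trans (cong (uncurry vertex) e) (combine-remQuot {p} 6 y))

  by-vertices : ∀ {P : Fin (p * 6) → Set} → (∀ i t → P (vertex i t)) → ∀ x → P x
  by-vertices {P} h x = subst P (combine-remQuot {p} 6 x) (h _ _)

  adj⇒∼ : ∀ {i s j t} → Adj (G p) (vertex i s) (vertex j t) → (i , s) ∼ (j , t)
  adj⇒∼ {i} {s} {j} {t} h =
    Gadj⇒∼ _ _ (subst₂ (λ a b → T (Gadj p a b)) (remQuot-combine i s) (remQuot-combine j t) h)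

  local⇒adj : ∀ {i s t} → Local s t → Adj (G p) (vertex i s) (vertex i t)
  local⇒adj {i} {s} {t} l = subst₂ (λ a b → T (Gadj p a b))
    (sym (remQuot-combine i s)) (sym (remQuot-combine i t)) (subst T (sym (Gadj-same-copy i s t)) l)

  adj⇒local : ∀ {i s t} → Adj (G p) (vertex i s) (vertex i t) → Local s t
  adj⇒local {i} {s} {t} h with adj⇒∼ {i} {s} {i} {t} h
  ... | local l = l
  ... | cycle i≢i _ = ⊥-elim (i≢i refl)

  inner-neighbour : ∀ {i s} → s ≢ U → ∀ y → Adj (G p) (vertex i s) y →
                    ∃ λ k → y ≡ vertex i k × Local s k
  inner-neighbour {i} {s} s≢U = by-vertices λ j t h → neighbour (adj⇒∼ h)
    where
    neighbour : ∀ {j t} → (i , s) ∼ (j , t) → ∃ λ k → vertex j t ≡ vertex i k × Local s k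
    neighbour (local l) = _ , refl , l
    neighbour (cycle _ _) = ⊥-elim (s≢U refl)

  simple : IsSimple (G p)
  simple = (λ x y → subst T (Gadj-sym (rq x) (rq y))) , (λ x → ∼-irrefl ∘ Gadj⇒∼ (rq x) (rq x))

  subcubic : Subcubic (G p)
  subcubic x = ∣p∣≤-cover (N (G p) x) (λ m y → Slot (rq x) m (rq y))
    (λ m s s′ → rq-injective (Slot-unique (rq x) m s s′))
    (λ y y∈N → ∼⇒Slot (Gadj⇒∼ (rq x) (rq y) (Equivalence.to (∈N⇔Adj (G p)) y∈N)))

  no-C4 : p ≢ 4 → NoC4 (G p)
  no-C4 p≢4 = ¬IsC4⇒NoC4 (G p) (∼-no-C4 p≢4 ∘ IsC4-map rq rq-injective (Gadj⇒∼ _ _))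

  vertex-injective : ∀ {i s j t} → vertex i s ≡ vertex j t → (i , s) ≡ (j , t)
  vertex-injective {i} {s} {j} {t} e =
    trans (sym (remQuot-combine i s)) (trans (cong rq e) (remQuot-combine j t))

  S₀ : Subset (p * 6)
  S₀ = concat (replicate p L₀)

  ∣S₀∣ : ∣ S₀ ∣ ≡ p * 5
  ∣S₀∣ = ∣concat-replicate∣ p L₀

  vertex∈S₀ : ∀ {i t} → t ∈ L₀ → vertex i t ∈ S₀
  vertex∈S₀ {i} {t} t∈L₀ = Equivalence.from (∈-concat (replicate p L₀) i t)
    (subst (t ∈_) (sym (lookup-replicate i L₀)) t∈L₀)

  S₀-dominates : ∀ x → ∃ λ y → Adj (G p) x y × y ∈ S₀
  S₀-dominates = by-vertices λ i s →
    let k , l , _ , k∈L₀ = L₀-dominates s in vertex i k , local⇒adj l , vertex∈S₀ k∈L₀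

  -- Vertices in different copies are separated by a non-root neighbour of the first one.
  S₀-separates : ∀ x y → x ≢ y → ¬ (∀ z → z ∈ S₀ → (Adj (G p) x z ⇔ Adj (G p) y z))
  S₀-separates = by-vertices λ i s → by-vertices λ j t → separates i s j t
    where
    separates : ∀ i s j t → vertex i s ≢ vertex j t →
                ¬ (∀ z → z ∈ S₀ → (Adj (G p) (vertex i s) z ⇔ Adj (G p) (vertex j t) z))
    separates i s j t _ agree with i ≟ j | L₀-dominates s
    ... | no i≢j | k , l , k≢U , k∈L₀
        with adj⇒∼ (Equivalence.to (agree _ (vertex∈S₀ k∈L₀)) (local⇒adj l))
    ...   | local _ = i≢j refl
    ...   | cycle _ _ = k≢U refl
    separates i s i t u≢v agree | yes refl | _ with L₀-separates s t (u≢v ∘ cong (vertex i))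
    ... | k , k∈L₀ , inj₁ (ls , ¬lt) =
      ¬lt (adj⇒local (Equivalence.to (agree _ (vertex∈S₀ k∈L₀)) (local⇒adj ls)))
    ... | k , k∈L₀ , inj₂ (¬ls , lt) =
      ¬ls (adj⇒local (Equivalence.from (agree _ (vertex∈S₀ k∈L₀)) (local⇒adj lt)))

  S₀-code : IsIOCode (G p) S₀
  S₀-code = S₀-dominates , S₀-separates

  blocks-identifying : ∀ (Ls : Vec (Subset 6) p) → IsIOCode (G p) (concat Ls) →
                       ∀ i → LocallyIdentifying (lookup Ls i)
  blocks-identifying Ls (dominates , separates) i = dominates′ , separates′
    where
    L = lookup Ls i
    ∈N∩L : ∀ s {k} → Local s k → vertex i k ∈ concat Ls → k ∈ N T₃* s ∩ L
    ∈N∩L s l k∈S =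
      x∈p∩q⁺ (Equivalence.from (∈N⇔Adj T₃* {s}) l , Equivalence.to (∈-concat Ls i _) k∈S)
    dominates′ : ∀ s → s ≢ U → Nonempty (N T₃* s ∩ L)
    dominates′ s s≢U with dominates (vertex i s)
    ... | y , h , y∈S with inner-neighbour s≢U y h
    ...   | k , refl , l = k , ∈N∩L s l y∈S
    transfer : ∀ {s t} → s ≢ U → N T₃* s ∩ L ≡ N T₃* t ∩ L →
               ∀ y → y ∈ concat Ls → Adj (G p) (vertex i s) y → Adj (G p) (vertex i t) y
    transfer {s} {t} s≢U eq y y∈S h with inner-neighbour s≢U y h
    ... | k , refl , l =
      let k∈Nt∩L = subst (k ∈_) eq (∈N∩L s l y∈S)
      in local⇒adj (Equivalence.to (∈N⇔Adj T₃* {t}) (p∩q⊆p (N T₃* t) L k∈Nt∩L))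
    separates′ : ∀ s t → s ≢ U → t ≢ U → s ≢ t → N T₃* s ∩ L ≢ N T₃* t ∩ L
    separates′ s t s≢U t≢U s≢t eq =
      separates (vertex i s) (vertex i t) (s≢t ∘ cong proj₂ ∘ vertex-injective)
        λ y y∈S → mk⇔ (transfer s≢U eq y y∈S) (transfer t≢U (sym eq) y y∈S)

  code-size : ∀ S → IsIOCode (G p) S → p * 5 ≤ ∣ S ∣
  code-size S code with group p 6 S
  ... | Ls , refl =
    ∣concat∣-lower Ls (λ i → LocallyIdentifying⇒5≤∣L∣ _ (blocks-identifying Ls code i))

proposition4 : (p : ℕ) → 3 ≤ p → p ≢ 4 →
    IsSimple (G p) × OpenTwinFree (G p) × Subcubic (G p) × NoC4 (G p) ×
    Σ ℕ (λ k → γIOC≡ (G p) k × 6 * k ≡ 5 * order (G p))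
proposition4 p _ p≢4 =
  simple , IsIOCode⇒OpenTwinFree (G p) S₀-code , subcubic , no-C4 p≢4 ,
  p * 5 , ((S₀ , S₀-code , ∣S₀∣) , code-size) , sizes
  where
  open Gₚ p
  sizes : 6 * (p * 5) ≡ 5 * (p * 6)
  sizes = trans (sym (*-assoc 6 p 5)) (trans (*-comm (6 * p) 5) (cong (5 *_) (*-comm 6 p)))
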